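{- Let $q\ge3$, $n\ge1$, and let $(T_+,T_-)$ be a pair of disjoint subsets of $\mathbb{Z}_q^n$. Then the following three conditions are equivalent: (D2) $T_+$ and $T_-$ are codes with code distance $4$, and for every $i\in\{1,\ldots,n\}$ the $i$-projection of $(T_+,T_-)$ is a perfect bitrade in $H(n-1,q)$; (D3) for every vertex $x$ of $H(n,q)$, $w_{T_+}(x)=w_{T_- }(x)\le1$; (D5) for every vertex $x$ of $H(n,q)$ and every $i\in\{1,\ldots,n\}$, $|C_{x,i}\cap T_+|=|C_{x,i}\cap T_-|\le1$.
   Context: $H(m,q)$ is the Hamming graph on $\mathbb{Z}_q^m$ (adjacent iff differing in exactly one coordinate), $d$ the Hamming distance, $S_i(x)=\{y:d(x,y)=i\}$, $B(x)=\{y:d(x,y)\le1\}$. A set of vertices is a code with code distance $d$ if any two distinct elements are at distance at least $d$. For $Z\subseteq\mathbb{Z}_q^n$, $w_Z(x)=|S_0(x)\cap Z|+|S_1(x)\cap Z|+\frac{2}{n}|S_2(x)\cap Z|$. $e^a_i$ is the vector with $a\in\mathbb{Z}_q$ in position $i$ and $0$ elsewhere; the cylinder is $C_{x,i}=\bigcup_{a\in\mathbb{Z}_q}B(x+e^a_i)$. For $x=(x_1,\dots,x_{n-1})\in\mathbb{Z}_q^{n-1}$, $x^a_i=(x_1,\ldots,x_{i-1},a,x_i,\ldots,x_{n-1})$. The $i$-projection of $C\subseteq\mathbb{Z}_q^n$ is $\{x\in\mathbb{Z}_q^{n-1}: x^a_i\in C\text{ for some }a\}$; with $A_\pm$ the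 $i$-projections of $T_\pm$, the $i$-projection of the pair is $(A_+\setminus A_-,A_-\setminus A_+)$. A perfect bitrade in $H(m,q)$ is a pair $(P_+,P_-)$ of disjoint vertex sets with $|B(x)\cap P_+|=|B(x)\cap P_-|\le1$ for every vertex $x$. -}

module Defs where

open import Data.Bool using (Bool; true; false; _∧_; not)
open import Data.Nat using (ℕ; zero; suc; _+_; _≤_; _≤ᵇ_; _%_; NonZero)
open import Data.Nat.DivMod using (m%n<n)
open import Data.Fin using (Fin; toℕ; fromℕ<)
open import Data.Fin.Properties using (_≟_)
open import Data.Vec using (Vec; []; _∷_; insertAt; updateAt)
open import Data.List using (List; []; _∷_; length; filterᵇ; concatMap; map; allFin)
open import Data.Bool.ListAction using (any)
open import Data.Integer using (+_)
open import Data.Rational using (ℚ; _/_) renaming (_+_ to _+ℚ_; _*_ to _*ℚ_)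
open import Data.Product using (_×_)
open import Relation.Nullary using (¬_; ⌊_⌋)
open import Relation.Binary.PropositionalEquality using (_≡_; _≢_)

-- Z_q with addition modulo q (Fin 0 is empty, so no case for q = 0 is needed)
_+q_ : ∀ {q} → Fin q → Fin q → Fin q
_+q_ {suc q} a b = fromℕ< (m%n<n (toℕ a + toℕ b) (suc q))

Word : ℕ → ℕ → Set
Word q n = Vec (Fin q) n

VSet : ℕ → ℕ → Set
VSet q n = Word q n → Bool

allWords : (q n : ℕ) → List (Word q n)
allWords q zero = [] ∷ []
allWords q (suc n) = concatMap (λ a → map (a ∷_) (allWords q n)) (allFin q)

count : ∀ {q n} → (Word q n → Bool) → ℕ
count {q} {n} P = length (filterᵇ P (allWords q n))

dist : ∀ {q n} → Word q n → Word q n → ℕ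
dist [] [] = 0
dist (a ∷ x) (b ∷ y) with ⌊ a ≟ b ⌋
... | true = dist x y
... | false = suc (dist x y)

sphereCount : ∀ {q n} → ℕ → Word q n → VSet q n → ℕ
sphereCount i x Z = count (λ y → Z y ∧ ⌊ dist x y Data.Nat.≟ i ⌋)

ballCount : ∀ {q n} → Word q n → VSet q n → ℕ
ballCount x Z = count (λ y → Z y ∧ (dist x y ≤ᵇ 1))

_∈ₛ_ : ∀ {q n} → Word q n → VSet q n → Set
x ∈ₛ Z = Z x ≡ true

Disjoint : ∀ {q n} → VSet q n → VSet q n → Set
Disjoint {q} {n} A B = ∀ (x : Word q n) → ¬ (x ∈ₛ A × x ∈ₛ B)

IsCode : ∀ {q n} → ℕ → VSet q n → Set
IsCode {q} {n} d Z = ∀ (x y : Word q n) → x ∈ₛ Z → y ∈ₛ Z → x ≢ y → d ≤ dist x y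

IsPerfectBitrade : ∀ {q n} → VSet q n → VSet q n → Set
IsPerfectBitrade {q} {n} P₊ P₋ =
  Disjoint P₊ P₋ ×
  (∀ (x : Word q n) → ballCount x P₊ ≡ ballCount x P₋ × ballCount x P₊ ≤ 1)

w : ∀ {q m} → VSet q (suc m) → Word q (suc m) → ℚ
w {q} {m} Z x =
  ((+ (sphereCount 0 x Z + sphereCount 1 x Z)) / 1)
  +ℚ ((+ 2 / suc m) *ℚ ((+ sphereCount 2 x Z) / 1))

_+e[_]_ : ∀ {q n} → Word q n → Fin n → Fin q → Word q n
x +e[ i ] a = updateAt x i (_+q a)

cylinder : ∀ {q n} → Word q n → Fin n → VSet q n
cylinder {q} x i y = any (λ a → dist (x +e[ i ] a) y ≤ᵇ 1) (allFin q)

cylCount : ∀ {q n} → Word q n → Fin n → VSet q n → ℕ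
cylCount x i Z = count (λ y → cylinder x i y ∧ Z y)

projection : ∀ {q m} → Fin (suc m) → VSet q (suc m) → VSet q m
projection {q} i C x = any (λ a → C (insertAt x i a)) (allFin q)

projPair₊ projPair₋ : ∀ {q m} → Fin (suc m) → VSet q (suc m) → VSet q (suc m) → VSet q m
projPair₊ i T₊ T₋ x = projection i T₊ x ∧ not (projection i T₋ x)
projPair₋ i T₊ T₋ x = projection i T₋ x ∧ not (projection i T₊ x)

D2 : ∀ {q m} → VSet q (suc m) → VSet q (suc m) → Set
D2 {q} {m} T₊ T₋ =
  IsCode 4 T₊ × IsCode 4 T₋ ×
  (∀ (i : Fin (suc m)) → IsPerfectBitrade (projPair₊ i T₊ T₋) (projPair₋ i T₊ T₋))

D3 : ∀ {q m} → VSet q (suc m) → VSet q (suc m) → Set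
D3 {q} {m} T₊ T₋ =
  ∀ (x : Word q (suc m)) → w T₊ x ≡ w T₋ x × w T₊ x Data.Rational.≤ (+ 1 / 1)

D5 : ∀ {q m} → VSet q (suc m) → VSet q (suc m) → Set
D5 {q} {m} T₊ T₋ =
  ∀ (x : Word q (suc m)) (i : Fin (suc m)) →
    cylCount x i T₊ ≡ cylCount x i T₋ × cylCount x i T₊ ≤ 1

-- Write x̂ for x with coordinate i deleted. The cylinder C_{x,i} consists of the words y with
-- d(x̂, ŷ) ≤ 1, so a word at distance d from x lies in all n cylinders C_{x,1}, …, C_{x,n} if
-- d ≤ 1, in two of them if d = 2 and in none otherwise; hence ∑ᵢ |C_{x,i} ∩ Z| = n · w_Z(x),
-- which gives (D5) ⇒ (D3). Conversely, (D3) forces code distance 4, so every cylinder meets T₊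
-- and T₋ at most once; and if C_{x,i} meets T₊ in u, then at the vertex y obtained from x by
-- setting yᵢ = uᵢ all n cylinders meet T₊, so w_{T₋}(y) = w_{T₊}(y) = 1 and C_{y,i} = C_{x,i}
-- meets T₋. Finally C_{x,i} ∩ T is the set of lifts of B(x̂) ∩ A, where A is the i-projection
-- of T, which translates (D5) into the bitrade property of the projected pair and back.

module Submission where

open import Defs
open import Data.Nat using (ℕ; suc; _≤_)
open import Data.Product using (_×_)
open import Function.Bundles using (_⇔_)

open import Data.Bool using (Bool; true; false; _∧_; not; if_then_else_)
import Data.Bool.Properties as Boolₚ
open import Data.Empty using (⊥; ⊥-elim)
open import Data.Fin using (Fin; zero; suc; toℕ; fromℕ<; punchIn)
open import Data.Fin.Properties using (_≟_; toℕ-fromℕ<; toℕ<n; toℕ-injective)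
import Data.Integer as ℤ
import Data.Integer.Properties as ℤₚ
open import Data.Integer.Tactic.RingSolver using (solve-∀)
open import Data.List as List using (List; []; _∷_; length; filterᵇ; map; allFin)
open import Data.List.Membership.Propositional using (_∈_; lose)
open import Data.List.Membership.Propositional.Properties
  using (∈-allFin; ∈-map⁺; ∈-map⁻; ∈-filter⁺; ∈-filter⁻; ∈-concat⁺′)
open import Data.List.Relation.Unary.All as All using (_∷_)
import Data.List.Relation.Unary.All.Properties as Allₚ
open import Data.List.Relation.Unary.AllPairs as AllPairs using ()
import Data.List.Relation.Unary.AllPairs.Properties as AllPairsₚ
open import Data.List.Relation.Unary.Any using (here; there; satisfied)
open import Data.List.Relation.Unary.Any.Properties using (any⁺; any⁻)
open import Data.List.Relation.Unary.Unique.Propositional using (Unique)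
import Data.List.Relation.Unary.Unique.Propositional.Properties as Uniqueₚ
open import Data.Nat as ℕ using (zero; _+_; _*_; _∸_; _<_; _≤ᵇ_; z≤n; s≤s; _%_)
open import Data.Nat.DivMod using (m%n<n; %-distribˡ-+; [m+n]%n≡m%n; m<n⇒m%n≡m)
import Data.Nat.Properties as ℕₚ
open import Data.Product as Product using (∃; _,_; proj₁; proj₂)
open import Data.Rational as ℚ using (_/_; toℚᵘ)
import Data.Rational.Properties as ℚₚ
open import Data.Rational.Unnormalised as ℚᵘ using (mkℚᵘ; *≡*; *≤*)
import Data.Rational.Unnormalised.Properties as ℚᵘₚ
open import Data.Vec using (Vec; []; _∷_; lookup; removeAt; insertAt; updateAt)
import Data.Vec.Properties as Vecₚ
import Data.Vec.Functional as Vector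
open import Function using (_∘_; const)
open import Function.Bundles using (mk⇔; Equivalence)
open import Relation.Nullary using (¬_; ⌊_⌋; yes; no)
open import Relation.Nullary.Decidable using (T?; fromWitness)
open import Data.Bool.ListAction using (any)
open import Relation.Binary.PropositionalEquality

open import Algebra.Properties.Semiring.Sum ℕₚ.+-*-semiring
  using (sum; sum-syntax; sum-cong-≗; sum-remove; ∑-comm; ∑-distrib-+; *-distribˡ-sum; *-distribʳ-sum)

𝟙[_] : Bool → ℕ
𝟙[ true ] = 1
𝟙[ false ] = 0

≤⇒≤ᵇ≡true : ∀ {m n} → m ≤ n → (m ≤ᵇ n) ≡ true
≤⇒≤ᵇ≡true m≤n = Equivalence.to Boolₚ.T-≡ (ℕₚ.≤⇒≤ᵇ m≤n)

≤ᵇ≡true⇒≤ : ∀ {m n} → (m ≤ᵇ n) ≡ true → m ≤ n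
≤ᵇ≡true⇒≤ {m} {n} eq = ℕₚ.≤ᵇ⇒≤ m n (Equivalence.from Boolₚ.T-≡ eq)

∑-const : ∀ n c → ∑[ i < n ] c ≡ n * c
∑-const zero c = refl
∑-const (suc n) c = cong (c +_) (∑-const n c)

∑-mono-≤ : ∀ {n} {f g : Fin n → ℕ} → (∀ i → f i ≤ g i) → sum f ≤ sum g
∑-mono-≤ {zero} f≤g = z≤n
∑-mono-≤ {suc n} f≤g = ℕₚ.+-mono-≤ (f≤g zero) (∑-mono-≤ (f≤g ∘ suc))

∑1≡n : ∀ n → ∑[ i < n ] 1 ≡ n
∑1≡n n = trans (∑-const n 1) (ℕₚ.*-identityʳ n)

∑≤n : ∀ {n} {f : Fin n → ℕ} → (∀ i → f i ≤ 1) → sum f ≤ n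
∑≤n {n} f≤1 = ℕₚ.≤-trans (∑-mono-≤ f≤1) (ℕₚ.≤-reflexive (∑1≡n n))

∑≡n⇒≡1 : ∀ {n} {f : Fin n → ℕ} → (∀ i → f i ≤ 1) → sum f ≡ n → ∀ i → f i ≡ 1
∑≡n⇒≡1 {suc n} {f} f≤1 ∑f≡n i = ℕₚ.≤-antisym (f≤1 i) (ℕₚ.+-cancelʳ-≤ n 1 (f i) (begin
  suc n                           ≡⟨ sym ∑f≡n ⟩
  sum f                           ≡⟨ sum-remove f ⟩
  f i + sum (Vector.removeAt f i) ≤⟨ ℕₚ.+-monoʳ-≤ (f i) (∑≤n (f≤1 ∘ punchIn i)) ⟩
  f i + n                         ∎))
  where open ℕₚ.≤-Reasoning

∑-positive : ∀ {n} (f : Fin n → ℕ) → 0 < sum f → ∃ λ i → 0 < f i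
∑-positive {suc n} f 0<∑ with f zero in f₀≡
... | suc _ = zero , subst (0 <_) (sym f₀≡) (s≤s z≤n)
... | zero with ∑-positive (f ∘ suc) 0<∑
...   | i , 0<fᵢ = suc i , 0<fᵢ

δ : ∀ {q} → Fin q → Fin q → ℕ
δ a b = if ⌊ a ≟ b ⌋ then 0 else 1

δ-refl : ∀ {q} (a : Fin q) → δ a a ≡ 0
δ-refl a with a ≟ a
... | yes _ = refl
... | no a≢a = ⊥-elim (a≢a refl)

δ≡0⇒≡ : ∀ {q} {a b : Fin q} → δ a b ≡ 0 → a ≡ b
δ≡0⇒≡ {a = a} {b} δ≡0 with a ≟ b
... | yes a≡b = a≡b
δ≡0⇒≡ () | no _

δ≤1 : ∀ {q} (a b : Fin q) → δ a b ≤ 1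
δ≤1 a b with ⌊ a ≟ b ⌋
... | true = z≤n
... | false = s≤s z≤n

δ-sym : ∀ {q} (a b : Fin q) → δ a b ≡ δ b a
δ-sym a b with a ≟ b | b ≟ a
... | yes _ | yes _ = refl
... | no _ | no _ = refl
... | yes a≡b | no b≢a = ⊥-elim (b≢a (sym a≡b))
... | no a≢b | yes b≡a = ⊥-elim (a≢b (sym b≡a))

δ-triangle : ∀ {q} (a b c : Fin q) → δ a c ≤ δ a b + δ b c
δ-triangle a b c with a ≟ b | b ≟ c
δ-triangle a _ _ | yes refl | yes refl = ℕₚ.≤-reflexive (δ-refl a)
δ-triangle a _ c | yes refl | no _ = δ≤1 a c
δ-triangle a _ c | no _ | _ = ℕₚ.≤-trans (δ≤1 a c) (ℕₚ.m≤m+n 1 _)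

dist-∷ : ∀ {q n} (a b : Fin q) (x y : Word q n) → dist (a ∷ x) (b ∷ y) ≡ δ a b + dist x y
dist-∷ a b x y with ⌊ a ≟ b ⌋
... | true = refl
... | false = refl

dist≡∑δ : ∀ {q n} (x y : Word q n) → dist x y ≡ ∑[ i < n ] δ (lookup x i) (lookup y i)
dist≡∑δ [] [] = refl
dist≡∑δ (a ∷ x) (b ∷ y) = trans (dist-∷ a b x y) (cong (δ a b +_) (dist≡∑δ x y))

dist-refl : ∀ {q n} (x : Word q n) → dist x x ≡ 0
dist-refl [] = refl
dist-refl (a ∷ x) = trans (dist-∷ a a x x) (cong₂ _+_ (δ-refl a) (dist-refl x))

dist-sym : ∀ {q n} (x y : Word q n) → dist x y ≡ dist y x
dist-sym x y = trans (dist≡∑δ x y)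
  (trans (sum-cong-≗ (λ i → δ-sym (lookup x i) (lookup y i))) (sym (dist≡∑δ y x)))

dist-triangle : ∀ {q n} (x y z : Word q n) → dist x z ≤ dist x y + dist y z
dist-triangle {n = n} x y z = begin
  dist x z             ≡⟨ dist≡∑δ x z ⟩
  ∑[ i < n ] δxz i     ≤⟨ ∑-mono-≤ (λ i → δ-triangle (lookup x i) (lookup y i) (lookup z i)) ⟩
  ∑[ i < n ] (δxy i + δyz i)    ≡⟨ ∑-distrib-+ δxy δyz ⟩
  sum δxy + sum δyz    ≡⟨ sym (cong₂ _+_ (dist≡∑δ x y) (dist≡∑δ y z)) ⟩
  dist x y + dist y z  ∎
  where
  open ℕₚ.≤-Reasoning
  δxy δyz δxz : Fin n → ℕ
  δxy i = δ (lookup x i) (lookup y i)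
  δyz i = δ (lookup y i) (lookup z i)
  δxz i = δ (lookup x i) (lookup z i)

dist≡0⇒≡ : ∀ {q n} {x y : Word q n} → dist x y ≡ 0 → x ≡ y
dist≡0⇒≡ {x = []} {[]} _ = refl
dist≡0⇒≡ {x = a ∷ x} {b ∷ y} d≡0 =
  cong₂ _∷_ (δ≡0⇒≡ (ℕₚ.m+n≡0⇒m≡0 _ δ+d≡0)) (dist≡0⇒≡ (ℕₚ.m+n≡0⇒n≡0 (δ a b) δ+d≡0))
  where
  δ+d≡0 : δ a b + dist x y ≡ 0
  δ+d≡0 = trans (sym (dist-∷ a b x y)) d≡0

dist≡suc⇒≢ : ∀ {q n} {u v : Word q n} {k} → dist u v ≡ suc k → u ≢ v
dist≡suc⇒≢ {u = u} d≡1+k refl = ℕₚ.0≢1+n (trans (sym (dist-refl u)) d≡1+k)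

lookup-removeAt : ∀ {A : Set} {n} (x : Vec A (suc n)) (i : Fin (suc n)) (j : Fin n) →
  lookup (removeAt x i) j ≡ lookup x (punchIn i j)
lookup-removeAt x i j = trans (sym (Vecₚ.insertAt-punchIn (removeAt x i) i (lookup x i) j))
  (cong (λ v → lookup v (punchIn i j)) (Vecₚ.insertAt-removeAt x i))

removeAt-updateAt : ∀ {A : Set} {n} (x : Vec A (suc n)) (i : Fin (suc n)) (f : A → A) →
  removeAt (updateAt x i f) i ≡ removeAt x i
removeAt-updateAt (a ∷ x) zero f = refl
removeAt-updateAt (a ∷ b ∷ x) (suc zero) f = refl
removeAt-updateAt (a ∷ b ∷ x) (suc (suc i)) f = cong (a ∷_) (removeAt-updateAt (b ∷ x) (suc i) f)

distExcept : ∀ {q n} → Fin (suc n) → Word q (suc n) → Word q (suc n) → ℕ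
distExcept i x y = dist (removeAt x i) (removeAt y i)

dist-removeAt : ∀ {q n} (x y : Word q (suc n)) (i : Fin (suc n)) →
  dist x y ≡ δ (lookup x i) (lookup y i) + distExcept i x y
dist-removeAt x y i = begin
  dist x y                           ≡⟨ dist≡∑δ x y ⟩
  sum δxy                            ≡⟨ sum-remove {i = i} δxy ⟩
  δxy i + sum (Vector.removeAt δxy i) ≡⟨ cong (δxy i +_) (sum-cong-≗ λ j →
                                          sym (cong₂ δ (lookup-removeAt x i j) (lookup-removeAt y i j))) ⟩
  δxy i + sum (λ j → δ (lookup (removeAt x i) j) (lookup (removeAt y i) j))
                                     ≡⟨ cong (δxy i +_) (sym (dist≡∑δ (removeAt x i) (removeAt y i))) ⟩
  δxy i + distExcept i x y           ∎
  where
  open ≡-Reasoning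
  δxy : Fin _ → ℕ
  δxy j = δ (lookup x j) (lookup y j)

distExcept≤dist : ∀ {q n} (x y : Word q (suc n)) (i : Fin (suc n)) → distExcept i x y ≤ dist x y
distExcept≤dist x y i = ℕₚ.≤-trans (ℕₚ.m≤n+m _ _) (ℕₚ.≤-reflexive (sym (dist-removeAt x y i)))

dist-updateAt : ∀ {q n} (x y : Word q (suc n)) (i : Fin (suc n)) (f : Fin q → Fin q) →
  dist (updateAt x i f) y ≡ δ (f (lookup x i)) (lookup y i) + distExcept i x y
dist-updateAt x y i f = trans (dist-removeAt (updateAt x i f) y i)
  (cong₂ (λ a z → δ a (lookup y i) + dist z (removeAt y i)) (Vecₚ.lookup∘updateAt i x) (removeAt-updateAt x i f))

differing-coordinate : ∀ {q n} (u v : Word q (suc n)) {k} → dist u v ≡ suc k →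
  ∃ λ i → δ (lookup u i) (lookup v i) ≡ 1 × distExcept i u v ≡ k
differing-coordinate u v {k} d≡1+k
  with ∑-positive _ (subst (0 <_) (trans (sym d≡1+k) (dist≡∑δ u v)) (s≤s z≤n))
... | i , 0<δᵢ = i , δᵢ≡1 , ℕₚ.suc-injective (sym (begin
  suc k                             ≡⟨ sym d≡1+k ⟩
  dist u v                          ≡⟨ dist-removeAt u v i ⟩
  δ (lookup u i) (lookup v i) + distExcept i u v ≡⟨ cong (_+ distExcept i u v) δᵢ≡1 ⟩
  suc (distExcept i u v)            ∎))
  where
  open ≡-Reasoning
  δᵢ≡1 : δ (lookup u i) (lookup v i) ≡ 1
  δᵢ≡1 = ℕₚ.≤-antisym (δ≤1 _ _) 0<δᵢ

step-towards : ∀ {q n} (u v : Word q n) {k} → dist u v ≡ suc k → ∃ λ x → dist u x ≡ 1 × dist x v ≡ k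
step-towards [] [] ()
step-towards u@(_ ∷ _) v d≡1+k with differing-coordinate u v d≡1+k
... | i , δᵢ≡1 , d̂≡k = x , d[u,x]≡1 , trans (dist-updateAt u v i _) (cong₂ _+_ (δ-refl (lookup v i)) d̂≡k)
  where
  x : Word _ (suc _)
  x = updateAt u i (const (lookup v i))
  d[u,x]≡1 : dist u x ≡ 1
  d[u,x]≡1 = trans (dist-sym u x) (trans (dist-updateAt u u i _)
    (cong₂ _+_ (trans (δ-sym (lookup v i) (lookup u i)) δᵢ≡1) (dist-refl (removeAt u i))))

midpoint : ∀ {q n} (a b : Word q n) → dist a b ≤ 2 → ∃ λ c → dist c a ≤ 1 × dist c b ≤ 1
midpoint a b d≤2 with dist a b in d≡
... | zero = a , ℕₚ.≤-trans (ℕₚ.≤-reflexive (dist-refl a)) z≤n , ℕₚ.≤-trans (ℕₚ.≤-reflexive d≡) z≤n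
... | suc k with step-towards a b d≡
...   | c , d[a,c]≡1 , d[c,b]≡k = c , ℕₚ.≤-reflexive (trans (dist-sym c a) d[a,c]≡1)
                                    , ℕₚ.≤-trans (ℕₚ.≤-reflexive d[c,b]≡k) (ℕₚ.≤-pred d≤2)

module _ {A : Set} where

  length≤1⇒≡ : ∀ {xs : List A} {u v} → length xs ≤ 1 → u ∈ xs → v ∈ xs → u ≡ v
  length≤1⇒≡ {_ ∷ []} _ (here refl) (here refl) = refl
  length≤1⇒≡ {_ ∷ _ ∷ _} (s≤s ()) _ _

  ≡⇒length≤1 : ∀ {xs : List A} → Unique xs → (∀ {u v} → u ∈ xs → v ∈ xs → u ≡ v) → length xs ≤ 1
  ≡⇒length≤1 {[]} _ _ = z≤n
  ≡⇒length≤1 {_ ∷ []} _ _ = s≤s z≤n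
  ≡⇒length≤1 {_ ∷ _ ∷ _} ((u≢v ∷ _) AllPairs.∷ _) same = ⊥-elim (u≢v (same (here refl) (there (here refl))))

  length-filterᵇ≡∑ : (p : A → Bool) (xs : List A) →
    length (filterᵇ p xs) ≡ ∑[ k < length xs ] 𝟙[ p (List.lookup xs k) ]
  length-filterᵇ≡∑ p [] = refl
  length-filterᵇ≡∑ p (x ∷ xs) with p x
  ... | true = cong suc (length-filterᵇ≡∑ p xs)
  ... | false = length-filterᵇ≡∑ p xs

∈-allWords : ∀ {q n} (x : Word q n) → x ∈ allWords q n
∈-allWords [] = here refl
∈-allWords {q} {suc n} (a ∷ x) =
  ∈-concat⁺′ (∈-map⁺ (a ∷_) (∈-allWords x)) (∈-map⁺ (λ b → map (b ∷_) (allWords q n)) (∈-allFin a))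

allWords-unique : ∀ q n → Unique (allWords q n)
allWords-unique q zero = All.[] AllPairs.∷ AllPairs.[]
allWords-unique q (suc n) = Uniqueₚ.concat⁺ (Allₚ.map⁺ (Allₚ.tabulate⁺ λ _ → unique-block))
  (AllPairsₚ.map⁺ (AllPairs.map disjoint (Uniqueₚ.allFin⁺ q)))
  where
  block : Fin q → List (Word q (suc n))
  block b = map (b ∷_) (allWords q n)
  unique-block : ∀ {b} → Unique (block b)
  unique-block = Uniqueₚ.map⁺ Vecₚ.∷-injectiveʳ (allWords-unique q n)
  disjoint : ∀ {a b} → a ≢ b → ∀ {v} → ¬ (v ∈ block a × v ∈ block b)
  disjoint a≢b (v∈a , v∈b) with ∈-map⁻ _ v∈a | ∈-map⁻ _ v∈b
  ... | _ , _ , refl | _ , _ , eq = a≢b (Vecₚ.∷-injectiveˡ eq)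

infixr 25 _∩_

_∩_ : ∀ {q n} → VSet q n → VSet q n → VSet q n
(A ∩ B) y = A y ∧ B y

∈-∩⁺ : ∀ {q n} {A B : VSet q n} {y} → y ∈ₛ A → y ∈ₛ B → y ∈ₛ A ∩ B
∈-∩⁺ y∈A y∈B rewrite y∈A | y∈B = refl

∈-∩⁻ : ∀ {q n} (A B : VSet q n) y → y ∈ₛ A ∩ B → y ∈ₛ A × y ∈ₛ B
∈-∩⁻ A B y y∈A∩B with A y | B y
... | true | true = refl , refl

ball : ∀ {q n} → Word q n → VSet q n
ball x y = dist x y ≤ᵇ 1

sphere : ∀ {q n} → ℕ → Word q n → VSet q n
sphere k x y = ⌊ dist x y ℕ.≟ k ⌋

Inhabited : ∀ {q n} → VSet q n → Set
Inhabited P = ∃ λ y → y ∈ₛ P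

AtMostOne : ∀ {q n} → VSet q n → Set
AtMostOne P = ∀ {u v} → u ∈ₛ P → v ∈ₛ P → u ≡ v

module _ {q n : ℕ} where

  members : VSet q n → List (Word q n)
  members P = filterᵇ P (allWords q n)

  ∈-members⁺ : ∀ {P y} → y ∈ₛ P → y ∈ members P
  ∈-members⁺ {P} {y} y∈P = ∈-filter⁺ (T? ∘ P) (∈-allWords y) (Equivalence.from Boolₚ.T-≡ y∈P)

  ∈-members⁻ : ∀ {P y} → y ∈ members P → y ∈ₛ P
  ∈-members⁻ {P} y∈ = Equivalence.to Boolₚ.T-≡ (proj₂ (∈-filter⁻ (T? ∘ P) {xs = allWords q n} y∈))

  count≤1⇒atMostOne : ∀ P → count P ≤ 1 → AtMostOne P
  count≤1⇒atMostOne P c≤1 u∈P v∈P = length≤1⇒≡ c≤1 (∈-members⁺ u∈P) (∈-members⁺ v∈P)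

  atMostOne⇒count≤1 : ∀ P → AtMostOne P → count P ≤ 1
  atMostOne⇒count≤1 P P≤1 = ≡⇒length≤1 (Uniqueₚ.filter⁺ (T? ∘ P) (allWords-unique q n))
    (λ u∈ v∈ → P≤1 (∈-members⁻ u∈) (∈-members⁻ v∈))

  inhabited⇒count≥1 : ∀ P → Inhabited P → 1 ≤ count P
  inhabited⇒count≥1 P (y , y∈P) with members P | ∈-members⁺ {P} y∈P
  ... | _ ∷ _ | _ = s≤s z≤n

  count≥1⇒inhabited : ∀ P → 1 ≤ count P → Inhabited P
  count≥1⇒inhabited P 1≤c with members P in eq
  ... | y ∷ _ = y , ∈-members⁻ {P} (subst (y ∈_) (sym eq) (here refl))

  count-mono : ∀ P Q → count P ≤ 1 → (Inhabited P → Inhabited Q) → count P ≤ count Q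
  count-mono P Q c≤1 P→Q with 1 ℕ.≤? count P
  ... | yes 1≤c = ℕₚ.≤-trans c≤1 (inhabited⇒count≥1 Q (P→Q (count≥1⇒inhabited P 1≤c)))
  ... | no 1≰c = ℕₚ.≤-trans (ℕₚ.≤-pred (ℕₚ.≰⇒> 1≰c)) z≤n

  count≡⇒inhabited : ∀ P Q → count P ≡ count Q → Inhabited P → Inhabited Q
  count≡⇒inhabited P Q cP≡cQ P≠∅ = count≥1⇒inhabited Q (subst (1 ≤_) cP≡cQ (inhabited⇒count≥1 P P≠∅))

  count-≡ : ∀ P Q → count P ≤ 1 → count Q ≤ 1 →
    (Inhabited P → Inhabited Q) → (Inhabited Q → Inhabited P) → count P ≡ count Q
  count-≡ P Q cP≤1 cQ≤1 P→Q Q→P = ℕₚ.≤-antisym (count-mono P Q cP≤1 P→Q) (count-mono Q P cQ≤1 Q→P)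

+q-surjective : ∀ {q} (c b : Fin q) → ∃ λ a → c +q a ≡ b
+q-surjective {suc q′} c b = fromℕ< (m%n<n x q) , toℕ-injective (begin
  toℕ (c +q fromℕ< (m%n<n x q))     ≡⟨ toℕ-fromℕ< _ ⟩
  (toℕ c + toℕ (fromℕ< (m%n<n x q))) % q ≡⟨ cong (λ t → (toℕ c + t) % q) (toℕ-fromℕ< (m%n<n x q)) ⟩
  (toℕ c + x % q) % q               ≡⟨ cong (λ t → (t + x % q) % q) (sym (m<n⇒m%n≡m (toℕ<n c))) ⟩
  (toℕ c % q + x % q) % q           ≡⟨ sym (%-distribˡ-+ (toℕ c) x q) ⟩
  (toℕ c + x) % q                   ≡⟨ cong (_% q) (sym (ℕₚ.+-assoc (toℕ c) (q ∸ toℕ c) (toℕ b))) ⟩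
  (toℕ c + (q ∸ toℕ c) + toℕ b) % q ≡⟨ cong (λ t → (t + toℕ b) % q) (ℕₚ.m+[n∸m]≡n (ℕₚ.<⇒≤ (toℕ<n c))) ⟩
  (q + toℕ b) % q                   ≡⟨ cong (_% q) (ℕₚ.+-comm q (toℕ b)) ⟩
  (toℕ b + q) % q                   ≡⟨ [m+n]%n≡m%n (toℕ b) q ⟩
  toℕ b % q                         ≡⟨ m<n⇒m%n≡m (toℕ<n b) ⟩
  toℕ b                             ∎)
  where
  open ≡-Reasoning
  q x : ℕ
  q = suc q′
  x = (q ∸ toℕ c) + toℕ b

any-allFin⇔ : ∀ {q} (p : Fin q → Bool) → any p (allFin q) ≡ true ⇔ (∃ λ a → p a ≡ true)
any-allFin⇔ {q} p = mk⇔
  (λ any≡true → Product.map₂ (to Boolₚ.T-≡) (satisfied (any⁻ p (allFin q) (from Boolₚ.T-≡ any≡true))))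
  (λ (a , pa) → to Boolₚ.T-≡ (any⁺ p (lose (∈-allFin a) (from Boolₚ.T-≡ pa))))
  where open Equivalence using (to; from)

∈-cylinder⁻ : ∀ {q n} (x : Word q (suc n)) i y → y ∈ₛ cylinder x i → distExcept i x y ≤ 1
∈-cylinder⁻ x i y y∈ with Equivalence.to (any-allFin⇔ _) y∈
... | a , d≤ᵇ1 = ℕₚ.≤-trans (ℕₚ.m≤n+m _ _)
  (ℕₚ.≤-trans (ℕₚ.≤-reflexive (sym (dist-updateAt x y i (_+q a)))) (≤ᵇ≡true⇒≤ d≤ᵇ1))

∈-cylinder⁺ : ∀ {q n} (x : Word q (suc n)) i y → distExcept i x y ≤ 1 → y ∈ₛ cylinder x i
∈-cylinder⁺ x i y d̂≤1 with +q-surjective (lookup x i) (lookup y i)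
... | a , xᵢ+a≡yᵢ = Equivalence.from (any-allFin⇔ _) (a , ≤⇒≤ᵇ≡true (ℕₚ.≤-trans (ℕₚ.≤-reflexive d≡d̂) d̂≤1))
  where
  d≡d̂ : dist (x +e[ i ] a) y ≡ distExcept i x y
  d≡d̂ = trans (dist-updateAt x y i (_+q a))
    (cong (_+ distExcept i x y) (trans (cong (λ b → δ b (lookup y i)) xᵢ+a≡yᵢ) (δ-refl (lookup y i))))

cylinder≡ : ∀ {q n} (x y : Word q (suc n)) i → cylinder x i y ≡ (distExcept i x y ≤ᵇ 1)
cylinder≡ x y i = Boolₚ.⇔→≡ (mk⇔ (≤⇒≤ᵇ≡true ∘ ∈-cylinder⁻ x i y) (∈-cylinder⁺ x i y ∘ ≤ᵇ≡true⇒≤))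

ball⊆cylinder : ∀ {q m} (y u : Word q (suc m)) j → dist y u ≤ 1 → u ∈ₛ cylinder y j
ball⊆cylinder y u j d≤1 = ∈-cylinder⁺ y j u (ℕₚ.≤-trans (distExcept≤dist y u j) d≤1)

cylinder-cong : ∀ {q m} (x x′ : Word q (suc m)) i v → removeAt x i ≡ removeAt x′ i →
  v ∈ₛ cylinder x i → v ∈ₛ cylinder x′ i
cylinder-cong x x′ i v x̂≡x̂′ v∈ =
  ∈-cylinder⁺ x′ i v (subst (λ z → dist z (removeAt v i) ≤ 1) x̂≡x̂′ (∈-cylinder⁻ x i v v∈))

cylinder-diameter : ∀ {q m} (x : Word q (suc m)) i u v → u ∈ₛ cylinder x i → v ∈ₛ cylinder x i → dist u v ≤ 3
cylinder-diameter x i u v u∈ v∈ = begin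
  dist u v
    ≡⟨ dist-removeAt u v i ⟩
  δ (lookup u i) (lookup v i) + dist û v̂
    ≤⟨ ℕₚ.+-mono-≤ (δ≤1 (lookup u i) (lookup v i)) (dist-triangle û x̂ v̂) ⟩
  1 + (dist û x̂ + dist x̂ v̂)
    ≡⟨ cong (λ d → 1 + (d + dist x̂ v̂)) (dist-sym û x̂) ⟩
  1 + (dist x̂ û + dist x̂ v̂)
    ≤⟨ ℕₚ.+-monoʳ-≤ 1 (ℕₚ.+-mono-≤ (∈-cylinder⁻ x i u u∈) (∈-cylinder⁻ x i v v∈)) ⟩
  3
    ∎
  where
  open ℕₚ.≤-Reasoning
  x̂ û v̂ : Word _ _
  x̂ = removeAt x i
  û = removeAt u i
  v̂ = removeAt v i

∈-projection⁺ : ∀ {q m} (i : Fin (suc m)) (C : VSet q (suc m)) v → v ∈ₛ C → removeAt v i ∈ₛ projection i C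
∈-projection⁺ i C v v∈C = Equivalence.from (any-allFin⇔ _)
  (lookup v i , subst (_∈ₛ C) (sym (Vecₚ.insertAt-removeAt v i)) v∈C)

∈-projection⁻ : ∀ {q m} (i : Fin (suc m)) (C : VSet q (suc m)) y → y ∈ₛ projection i C →
  ∃ λ v → v ∈ₛ C × removeAt v i ≡ y
∈-projection⁻ i C y y∈ with Equivalence.to (any-allFin⇔ _) y∈
... | a , yᵃ∈C = insertAt y i a , yᵃ∈C , Vecₚ.removeAt-insertAt y i a

-- Double counting

𝟙[≤1]-split : ∀ {d} r → d ≤ 1 → 𝟙[ r ≤ᵇ 1 ] ≡ 𝟙[ d + r ≤ᵇ 1 ] + d * 𝟙[ ⌊ d + r ℕ.≟ 2 ⌋ ]
𝟙[≤1]-split r z≤n = sym (ℕₚ.+-identityʳ _)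
𝟙[≤1]-split zero (s≤s z≤n) = refl
𝟙[≤1]-split (suc zero) (s≤s z≤n) = refl
𝟙[≤1]-split (suc (suc r)) (s≤s z≤n) = refl

𝟙[≤1]≡𝟙[≡0]+𝟙[≡1] : ∀ d → 𝟙[ d ≤ᵇ 1 ] ≡ 𝟙[ ⌊ d ℕ.≟ 0 ⌋ ] + 𝟙[ ⌊ d ℕ.≟ 1 ⌋ ]
𝟙[≤1]≡𝟙[≡0]+𝟙[≡1] zero = refl
𝟙[≤1]≡𝟙[≡0]+𝟙[≡1] (suc zero) = refl
𝟙[≤1]≡𝟙[≡0]+𝟙[≡1] (suc (suc d)) = refl

*𝟙[≡2] : ∀ d → d * 𝟙[ ⌊ d ℕ.≟ 2 ⌋ ] ≡ 2 * 𝟙[ ⌊ d ℕ.≟ 2 ⌋ ]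
*𝟙[≡2] zero = refl
*𝟙[≡2] (suc zero) = refl
*𝟙[≡2] (suc (suc zero)) = refl
*𝟙[≡2] (suc (suc (suc d))) = ℕₚ.*-zeroʳ (suc (suc (suc d)))

-- Deleting coordinate i lowers the distance d by δᵢ ∈ {0, 1}, and ∑ δᵢ = d: a word at distance
-- d ≤ 1 is counted for every i, at distance 2 for its two differing coordinates, otherwise never.
∑𝟙[distExcept≤1] : ∀ {q m} (x y : Word q (suc m)) →
  ∑[ i < suc m ] 𝟙[ distExcept i x y ≤ᵇ 1 ] ≡ suc m * 𝟙[ dist x y ≤ᵇ 1 ] + 2 * 𝟙[ ⌊ dist x y ℕ.≟ 2 ⌋ ]
∑𝟙[distExcept≤1] {m = m} x y = begin
  ∑[ i < n ] 𝟙[ distExcept i x y ≤ᵇ 1 ]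
    ≡⟨ sum-cong-≗ split ⟩
  ∑[ i < n ] (𝟙[ d ≤ᵇ 1 ] + δs i * e)
    ≡⟨ ∑-distrib-+ (const 𝟙[ d ≤ᵇ 1 ]) (λ i → δs i * e) ⟩
  ∑[ i < n ] 𝟙[ d ≤ᵇ 1 ] + ∑[ i < n ] (δs i * e)
    ≡⟨ cong₂ _+_ (∑-const n _) (sym (*-distribʳ-sum e δs)) ⟩
  n * 𝟙[ d ≤ᵇ 1 ] + sum δs * e
    ≡⟨ cong (λ s → n * 𝟙[ d ≤ᵇ 1 ] + s * e) (sym (dist≡∑δ x y)) ⟩
  n * 𝟙[ d ≤ᵇ 1 ] + d * e
    ≡⟨ cong (n * 𝟙[ d ≤ᵇ 1 ] +_) (*𝟙[≡2] d) ⟩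
  n * 𝟙[ d ≤ᵇ 1 ] + 2 * e
    ∎
  where
  open ≡-Reasoning
  n d e : ℕ
  n = suc m
  d = dist x y
  e = 𝟙[ ⌊ d ℕ.≟ 2 ⌋ ]
  δs : Fin n → ℕ
  δs i = δ (lookup x i) (lookup y i)
  split : ∀ i → 𝟙[ distExcept i x y ≤ᵇ 1 ] ≡ 𝟙[ d ≤ᵇ 1 ] + δs i * e
  split i = trans (𝟙[≤1]-split (distExcept i x y) (δ≤1 (lookup x i) (lookup y i)))
    (cong (λ t → 𝟙[ t ≤ᵇ 1 ] + δs i * 𝟙[ ⌊ t ℕ.≟ 2 ⌋ ]) (sym (dist-removeAt x y i)))

∑𝟙[cylinder∩] : ∀ {q m} (Z : VSet q (suc m)) (x w : Word q (suc m)) →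
  let s : ℕ → ℕ
      s k = 𝟙[ Z w ∧ ⌊ dist x w ℕ.≟ k ⌋ ]
  in ∑[ i < suc m ] 𝟙[ cylinder x i w ∧ Z w ] ≡ suc m * (s 0 + s 1) + 2 * s 2
∑𝟙[cylinder∩] {m = m} Z x w with Z w
... | false = begin
  ∑[ i < n ] 𝟙[ cylinder x i w ∧ false ] ≡⟨ sum-cong-≗ (λ i → cong 𝟙[_] (Boolₚ.∧-zeroʳ (cylinder x i w))) ⟩
  ∑[ i < n ] 0                           ≡⟨ ∑-const n 0 ⟩
  n * 0                                  ≡⟨ sym (ℕₚ.+-identityʳ _) ⟩
  n * 0 + 0                              ∎
  where
  open ≡-Reasoning
  n : ℕ
  n = suc m
... | true = begin
  ∑[ i < n ] 𝟙[ cylinder x i w ∧ true ]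
    ≡⟨ sum-cong-≗ (λ i → cong 𝟙[_] (trans (Boolₚ.∧-identityʳ _) (cylinder≡ x w i))) ⟩
  ∑[ i < n ] 𝟙[ distExcept i x w ≤ᵇ 1 ]
    ≡⟨ ∑𝟙[distExcept≤1] x w ⟩
  n * 𝟙[ d ≤ᵇ 1 ] + 2 * 𝟙[ ⌊ d ℕ.≟ 2 ⌋ ]
    ≡⟨ cong (λ t → n * t + 2 * 𝟙[ ⌊ d ℕ.≟ 2 ⌋ ]) (𝟙[≤1]≡𝟙[≡0]+𝟙[≡1] d) ⟩
  n * (𝟙[ ⌊ d ℕ.≟ 0 ⌋ ] + 𝟙[ ⌊ d ℕ.≟ 1 ⌋ ]) + 2 * 𝟙[ ⌊ d ℕ.≟ 2 ⌋ ]
    ∎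
  where
  open ≡-Reasoning
  n d : ℕ
  n = suc m
  d = dist x w

-- n · w_Z(x)
weight : ∀ {q m} → VSet q (suc m) → Word q (suc m) → ℕ
weight {m = m} Z x = suc m * (sphereCount 0 x Z + sphereCount 1 x Z) + 2 * sphereCount 2 x Z

∑cylCount≡weight : ∀ {q m} (Z : VSet q (suc m)) (x : Word q (suc m)) → ∑[ i < suc m ] cylCount x i Z ≡ weight Z x
∑cylCount≡weight {q} {m} Z x = begin
  ∑[ i < n ] cylCount x i Z
    ≡⟨ sum-cong-≗ (λ i → length-filterᵇ≡∑ (cylinder x i ∩ Z) W) ⟩
  ∑[ i < n ] ∑[ k < N ] c i k
    ≡⟨ ∑-comm c ⟩
  ∑[ k < N ] ∑[ i < n ] c i k
    ≡⟨ sum-cong-≗ (λ k → ∑𝟙[cylinder∩] Z x (word k)) ⟩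
  ∑[ k < N ] (n * (s₀ k + s₁ k) + 2 * s₂ k)
    ≡⟨ ∑-distrib-+ (λ k → n * (s₀ k + s₁ k)) (λ k → 2 * s₂ k) ⟩
  ∑[ k < N ] (n * (s₀ k + s₁ k)) + ∑[ k < N ] (2 * s₂ k)
    ≡⟨ sym (cong₂ _+_ (*-distribˡ-sum n (λ k → s₀ k + s₁ k)) (*-distribˡ-sum 2 s₂)) ⟩
  n * ∑[ k < N ] (s₀ k + s₁ k) + 2 * sum s₂
    ≡⟨ cong (λ t → n * t + 2 * sum s₂) (∑-distrib-+ s₀ s₁) ⟩
  n * (sum s₀ + sum s₁) + 2 * sum s₂
    ≡⟨ sym (cong₂ (λ a b → n * a + 2 * b) (cong₂ _+_ (sphereCount≡∑ 0) (sphereCount≡∑ 1)) (sphereCount≡∑ 2)) ⟩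
  weight Z x
    ∎
  where
  open ≡-Reasoning
  n N : ℕ
  n = suc m
  W : List (Word q n)
  W = allWords q n
  N = length W
  word : Fin N → Word q n
  word = List.lookup W
  c : Fin n → Fin N → ℕ
  c i k = 𝟙[ cylinder x i (word k) ∧ Z (word k) ]
  s : ℕ → Fin N → ℕ
  s j k = 𝟙[ Z (word k) ∧ ⌊ dist x (word k) ℕ.≟ j ⌋ ]
  s₀ s₁ s₂ : Fin N → ℕ
  s₀ = s 0
  s₁ = s 1
  s₂ = s 2
  sphereCount≡∑ : ∀ j → sphereCount j x Z ≡ sum (s j)
  sphereCount≡∑ j = length-filterᵇ≡∑ (λ y → Z y ∧ ⌊ dist x y ℕ.≟ j ⌋) W

-- Condition (D3) over the natural numbers

/1+/n*/1≃ : ∀ m (a b c : ℤ.ℤ) →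
  mkℚᵘ a 0 ℚᵘ.+ mkℚᵘ c m ℚᵘ.* mkℚᵘ b 0 ℚᵘ.≃ mkℚᵘ (ℤ.+ suc m ℤ.* a ℤ.+ c ℤ.* b) m
/1+/n*/1≃ m a b c = *≡* (identity a b c (ℤ.+ suc m))
  where
  -- the cross-multiplied fractions exactly as ℚᵘ's _+_ and _*_ build them, with n = + suc m
  identity : ∀ a b c n →
    (a ℤ.* (n ℤ.* ℤ.1ℤ) ℤ.+ c ℤ.* b ℤ.* ℤ.1ℤ) ℤ.* n ≡ (n ℤ.* a ℤ.+ c ℤ.* b) ℤ.* (ℤ.1ℤ ℤ.* (n ℤ.* ℤ.1ℤ))
  identity = solve-∀

w≡weight/n : ∀ {q m} (Z : VSet q (suc m)) (x : Word q (suc m)) → w Z x ≡ (ℤ.+ weight Z x) / suc m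
w≡weight/n {m = m} Z x = ℚₚ.toℚᵘ-injective (begin
  toℚᵘ (w Z x)
    ≈⟨ ℚₚ.toℚᵘ-homo-+ A/1 (2/n ℚ.* B/1) ⟩
  toℚᵘ A/1 ℚᵘ.+ toℚᵘ (2/n ℚ.* B/1)
    ≈⟨ ℚᵘₚ.+-cong (ℚₚ.toℚᵘ-fromℚᵘ (mkℚᵘ (ℤ.+ A) 0))
         (ℚᵘₚ.≃-trans (ℚₚ.toℚᵘ-homo-* 2/n B/1)
           (ℚᵘₚ.*-cong (ℚₚ.toℚᵘ-fromℚᵘ (mkℚᵘ (ℤ.+ 2) m)) (ℚₚ.toℚᵘ-fromℚᵘ (mkℚᵘ (ℤ.+ B) 0)))) ⟩
  mkℚᵘ (ℤ.+ A) 0 ℚᵘ.+ mkℚᵘ (ℤ.+ 2) m ℚᵘ.* mkℚᵘ (ℤ.+ B) 0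
    ≈⟨ /1+/n*/1≃ m (ℤ.+ A) (ℤ.+ B) (ℤ.+ 2) ⟩
  mkℚᵘ (ℤ.+ suc m ℤ.* ℤ.+ A ℤ.+ ℤ.+ 2 ℤ.* ℤ.+ B) m
    ≡⟨ cong (λ t → mkℚᵘ t m) (sym (cong₂ ℤ._+_ (ℤₚ.pos-* (suc m) A) (ℤₚ.pos-* 2 B))) ⟩
  mkℚᵘ (ℤ.+ weight Z x) m
    ≈⟨ ℚᵘₚ.≃-sym (ℚₚ.toℚᵘ-fromℚᵘ _) ⟩
  toℚᵘ ((ℤ.+ weight Z x) / suc m)
    ∎)
  where
  open ℚᵘₚ.≃-Reasoning
  A B : ℕ
  A = sphereCount 0 x Z + sphereCount 1 x Z
  B = sphereCount 2 x Z
  A/1 2/n B/1 : ℚ.ℚ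
  A/1 = ℤ.+ A / 1
  2/n = ℤ.+ 2 / suc m
  B/1 = ℤ.+ B / 1

/n-injective : ∀ {m a b} → (ℤ.+ a) / suc m ≡ (ℤ.+ b) / suc m → a ≡ b
/n-injective {m} {a} {b} eq with ℚₚ.fromℚᵘ-injective {mkℚᵘ (ℤ.+ a) m} {mkℚᵘ (ℤ.+ b) m} eq
... | *≡* a*n≡b*n = ℤₚ.+-injective (ℤₚ.*-cancelʳ-≡ _ _ (ℤ.+ suc m) a*n≡b*n)

/n≤1⇔ : ∀ {m a} → (ℤ.+ a) / suc m ℚ.≤ ℚ.1ℚ ⇔ a ≤ suc m
/n≤1⇔ {m} {a} = mk⇔ to from
  where
  a/n≃ : toℚᵘ ((ℤ.+ a) / suc m) ℚᵘ.≃ mkℚᵘ (ℤ.+ a) m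
  a/n≃ = ℚₚ.toℚᵘ-fromℚᵘ _
  1≃ : toℚᵘ ℚ.1ℚ ℚᵘ.≃ mkℚᵘ (ℤ.+ 1) 0
  1≃ = ℚₚ.toℚᵘ-fromℚᵘ _
  to : (ℤ.+ a) / suc m ℚ.≤ ℚ.1ℚ → a ≤ suc m
  to le with ℚᵘₚ.≤-respʳ-≃ 1≃ (ℚᵘₚ.≤-respˡ-≃ a/n≃ (ℚₚ.toℚᵘ-mono-≤ le))
  ... | *≤* a*1≤1*n = ℤₚ.drop‿+≤+ (subst₂ ℤ._≤_ (ℤₚ.*-identityʳ _) (ℤₚ.*-identityˡ _) a*1≤1*n)
  from : a ≤ suc m → (ℤ.+ a) / suc m ℚ.≤ ℚ.1ℚ
  from a≤n = ℚₚ.toℚᵘ-cancel-≤ (ℚᵘₚ.≤-respʳ-≃ (ℚᵘₚ.≃-sym 1≃) (ℚᵘₚ.≤-respˡ-≃ (ℚᵘₚ.≃-sym a/n≃)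
    (*≤* (subst₂ ℤ._≤_ (sym (ℤₚ.*-identityʳ _)) (sym (ℤₚ.*-identityˡ _)) (ℤ.+≤+ a≤n)))))

D3′ : ∀ {q m} → VSet q (suc m) → VSet q (suc m) → Set
D3′ {q} {m} T₊ T₋ = ∀ (x : Word q (suc m)) → weight T₊ x ≡ weight T₋ x × weight T₊ x ≤ suc m

D3⇔D3′ : ∀ {q m} (T₊ T₋ : VSet q (suc m)) → D3 T₊ T₋ ⇔ D3′ T₊ T₋
D3⇔D3′ {m = m} T₊ T₋ = mk⇔
  (λ d3 x → /n-injective (trans (sym (w≡weight/n T₊ x)) (trans (proj₁ (d3 x)) (w≡weight/n T₋ x)))
          , Equivalence.to /n≤1⇔ (subst (ℚ._≤ ℚ.1ℚ) (w≡weight/n T₊ x) (proj₂ (d3 x))))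
  (λ d3′ x → trans (w≡weight/n T₊ x)
                 (trans (cong (λ k → ℤ.+ k / suc m) (proj₁ (d3′ x))) (sym (w≡weight/n T₋ x)))
           , subst (ℚ._≤ ℚ.1ℚ) (sym (w≡weight/n T₊ x)) (Equivalence.from /n≤1⇔ (proj₂ (d3′ x))))

code-intro : ∀ {q n} {Z : VSet q n} →
  (∀ {u v k} → u ∈ₛ Z → v ∈ₛ Z → dist u v ≡ suc k → k ≤ 2 → ⊥) → IsCode 4 Z
code-intro close⇒⊥ u v u∈Z v∈Z u≢v with dist u v in d≡
... | zero = ⊥-elim (u≢v (dist≡0⇒≡ d≡))
... | suc k with k ℕ.≤? 2
...   | yes k≤2 = ⊥-elim (close⇒⊥ u∈Z v∈Z d≡ k≤2)
...   | no k≰2 = s≤s (ℕₚ.≰⇒> k≰2)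

code⇒cylCount≤1 : ∀ {q m} {Z : VSet q (suc m)} → IsCode 4 Z → ∀ x i → cylCount x i Z ≤ 1
code⇒cylCount≤1 {Z = Z} code x i = atMostOne⇒count≤1 (cylinder x i ∩ Z) same
  where
  same : AtMostOne (cylinder x i ∩ Z)
  same {u} {v} u∈ v∈ with Vecₚ.≡-dec _≟_ u v
  ... | yes u≡v = u≡v
  ... | no u≢v =
    let (u∈C , u∈Z) = ∈-∩⁻ (cylinder x i) Z u u∈
        (v∈C , v∈Z) = ∈-∩⁻ (cylinder x i) Z v v∈
    in ⊥-elim (ℕₚ.<⇒≱ (s≤s (cylinder-diameter x i u v u∈C v∈C)) (code u v u∈Z v∈Z u≢v))

cylCount≤1⇒code : ∀ {q m} {Z : VSet q (suc m)} → (∀ x i → cylCount x i Z ≤ 1) → IsCode 4 Z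
cylCount≤1⇒code {Z = Z} cyl≤1 = code-intro close⇒⊥
  where
  close⇒⊥ : ∀ {u v k} → u ∈ₛ Z → v ∈ₛ Z → dist u v ≡ suc k → k ≤ 2 → ⊥
  close⇒⊥ {u} {v} u∈Z v∈Z d≡1+k k≤2 with differing-coordinate u v d≡1+k
  ... | i , _ , d̂≡k with midpoint (removeAt u i) (removeAt v i) (subst (_≤ 2) (sym d̂≡k) k≤2)
  ...   | c , c~û , c~v̂ = dist≡suc⇒≢ d≡1+k
    (count≤1⇒atMostOne (cylinder x i ∩ Z) (cyl≤1 x i) (∈-C∩Z u∈Z c~û) (∈-C∩Z v∈Z c~v̂))
    where
    x : Word _ (suc _)
    x = insertAt c i (lookup u i)
    ∈-C∩Z : ∀ {w} → w ∈ₛ Z → dist c (removeAt w i) ≤ 1 → w ∈ₛ cylinder x i ∩ Z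
    ∈-C∩Z {w} w∈Z c~ŵ = ∈-∩⁺ {A = cylinder x i} {Z} (∈-cylinder⁺ x i w
      (subst (λ z → dist z (removeAt w i) ≤ 1) (sym (Vecₚ.removeAt-insertAt c i (lookup u i))) c~ŵ)) w∈Z

sphereCount≥1 : ∀ {q n} (Z : VSet q n) x w {k} → w ∈ₛ Z → dist x w ≡ k → 1 ≤ sphereCount k x Z
sphereCount≥1 Z x w {k} w∈Z d≡k = inhabited⇒count≥1 (Z ∩ sphere k x)
  (w , ∈-∩⁺ {A = Z} {sphere k x} w∈Z (Equivalence.to Boolₚ.T-≡ (fromWitness d≡k)))

weight-bound : ∀ m {a c} → 1 ≤ a → 2 ≤ a + c → suc m < suc m * a + 2 * c
weight-bound m {suc a} {c} _ 2≤a+c = begin-strict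
  suc m                        <⟨ ℕₚ.m<m+n (suc m) (0<rest a 2≤a+c) ⟩
  suc m + (suc m * a + 2 * c)  ≡⟨ sym (ℕₚ.+-assoc (suc m) _ _) ⟩
  suc m + suc m * a + 2 * c    ≡⟨ cong (_+ 2 * c) (sym (ℕₚ.*-suc (suc m) a)) ⟩
  suc m * suc a + 2 * c        ∎
  where
  open ℕₚ.≤-Reasoning
  0<rest : ∀ a → 2 ≤ suc a + c → 0 < suc m * a + 2 * c
  0<rest zero (s≤s 1≤c) = ℕₚ.≤-trans (ℕₚ.≤-trans 1≤c (ℕₚ.m≤m+n c _)) (ℕₚ.m≤n+m (2 * c) (suc m * 0))
  0<rest (suc a) _ = ℕₚ.≤-trans (s≤s z≤n) (ℕₚ.m≤m+n (suc m * suc a) (2 * c))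

-- Codewords at distance 1, 2 or 3 give a vertex of weight > n: the first of them or, at
-- distance 3, its neighbour towards the second.
weight≤n⇒code : ∀ {q m} {Z : VSet q (suc m)} → (∀ x → weight Z x ≤ suc m) → IsCode 4 Z
weight≤n⇒code {m = m} {Z} weight≤n = code-intro close⇒⊥
  where
  S : ℕ → Word _ (suc m) → ℕ
  S k x = sphereCount k x Z
  overweight : ∀ x → 1 ≤ S 0 x + S 1 x → 2 ≤ (S 0 x + S 1 x) + S 2 x → ⊥
  overweight x 1≤a 2≤a+c = ℕₚ.<⇒≱ (weight-bound m 1≤a 2≤a+c) (weight≤n x)
  close⇒⊥ : ∀ {u v k} → u ∈ₛ Z → v ∈ₛ Z → dist u v ≡ suc k → k ≤ 2 → ⊥
  close⇒⊥ {u} {v} {zero} u∈Z v∈Z d≡1 _ = overweight u (ℕₚ.≤-trans u∈S₀ (ℕₚ.m≤m+n _ _))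
    (ℕₚ.≤-trans (ℕₚ.+-mono-≤ u∈S₀ (sphereCount≥1 Z u v v∈Z d≡1)) (ℕₚ.m≤m+n _ _))
    where
    u∈S₀ : 1 ≤ S 0 u
    u∈S₀ = sphereCount≥1 Z u u u∈Z (dist-refl u)
  close⇒⊥ {u} {v} {suc zero} u∈Z v∈Z d≡2 _ = overweight u 1≤a
    (ℕₚ.+-mono-≤ 1≤a (sphereCount≥1 Z u v v∈Z d≡2))
    where
    1≤a : 1 ≤ S 0 u + S 1 u
    1≤a = ℕₚ.≤-trans (sphereCount≥1 Z u u u∈Z (dist-refl u)) (ℕₚ.m≤m+n _ _)
  close⇒⊥ {u} {v} {suc (suc zero)} u∈Z v∈Z d≡3 _ with step-towards u v d≡3
  ... | x , d[u,x]≡1 , d[x,v]≡2 = overweight x 1≤a (ℕₚ.+-mono-≤ 1≤a (sphereCount≥1 Z x v v∈Z d[x,v]≡2))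
    where
    1≤a : 1 ≤ S 0 x + S 1 x
    1≤a = ℕₚ.≤-trans (sphereCount≥1 Z x u u∈Z (trans (dist-sym x u) d[u,x]≡1)) (ℕₚ.m≤n+m _ _)
  close⇒⊥ {k = suc (suc (suc _))} _ _ _ (s≤s (s≤s ()))

-- Moving points of a cylinder from T₁ to T₂

module _ {q m} {T₁ T₂ : VSet q (suc m)} (code₁ : IsCode 4 T₁) (code₂ : IsCode 4 T₂)
         (weight≡ : ∀ y → weight T₁ y ≡ weight T₂ y) where

  -- u lies in all n cylinders through y, so y has weight n for T₁, hence for T₂; then every
  -- cylinder through y meets T₂, in particular C_{y,i} = C_{x,i}.
  weight-transfer : ∀ x i → Inhabited (cylinder x i ∩ T₁) → Inhabited (cylinder x i ∩ T₂)
  weight-transfer x i (u , u∈CT₁) =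
    let (v , v∈CT₂) = count≥1⇒inhabited (cylinder y i ∩ T₂) (ℕₚ.≤-reflexive (sym (full₂ i)))
        (v∈C , v∈T₂) = ∈-∩⁻ (cylinder y i) T₂ v v∈CT₂
    in v , ∈-∩⁺ {A = cylinder x i} {T₂} (cylinder-cong y x i v (removeAt-updateAt x i _) v∈C) v∈T₂
    where
    y : Word q (suc m)
    y = updateAt x i (const (lookup u i))
    y~u : dist y u ≤ 1
    y~u = subst (_≤ 1) (sym (trans (dist-updateAt x u i _) (cong (_+ distExcept i x u) (δ-refl (lookup u i)))))
      (∈-cylinder⁻ x i u (proj₁ (∈-∩⁻ (cylinder x i) T₁ u u∈CT₁)))
    full₁ : ∀ j → cylCount y j T₁ ≡ 1
    full₁ j = ℕₚ.≤-antisym (code⇒cylCount≤1 code₁ y j) (inhabited⇒count≥1 (cylinder y j ∩ T₁)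
      (u , ∈-∩⁺ {A = cylinder y j} {T₁} (ball⊆cylinder y u j y~u) (proj₂ (∈-∩⁻ (cylinder x i) T₁ u u∈CT₁))))
    full₂ : ∀ j → cylCount y j T₂ ≡ 1
    full₂ = ∑≡n⇒≡1 (code⇒cylCount≤1 code₂ y) (begin
      ∑[ j < suc m ] cylCount y j T₂ ≡⟨ ∑cylCount≡weight T₂ y ⟩
      weight T₂ y                    ≡⟨ sym (weight≡ y) ⟩
      weight T₁ y                    ≡⟨ sym (∑cylCount≡weight T₁ y) ⟩
      ∑[ j < suc m ] cylCount y j T₁ ≡⟨ sum-cong-≗ full₁ ⟩
      ∑[ j < suc m ] 1               ≡⟨ ∑1≡n (suc m) ⟩
      suc m                          ∎)
      where open ≡-Reasoning

module _ {q m} (i : Fin (suc m)) (x : Word q (suc m)) {y : Word q m} (x̂≡y : removeAt x i ≡ y) where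

  cylinder∩⇒projection∩ball : ∀ T v → v ∈ₛ cylinder x i ∩ T →
    removeAt v i ∈ₛ projection i T × dist y (removeAt v i) ≤ 1
  cylinder∩⇒projection∩ball T v v∈CT =
    let (v∈C , v∈T) = ∈-∩⁻ (cylinder x i) T v v∈CT
    in ∈-projection⁺ i T v v∈T , subst (λ z → dist z (removeAt v i) ≤ 1) x̂≡y (∈-cylinder⁻ x i v v∈C)

  projection∩ball⇒cylinder∩ : ∀ T v′ → v′ ∈ₛ projection i T → dist y v′ ≤ 1 →
    ∃ λ v → v ∈ₛ cylinder x i ∩ T × removeAt v i ≡ v′
  projection∩ball⇒cylinder∩ T v′ v′∈A y~v′ =
    let (v , v∈T , v̂≡v′) = ∈-projection⁻ i T v′ v′∈A
    in v , ∈-∩⁺ {A = cylinder x i} {T} (∈-cylinder⁺ x i v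
             (subst₂ (λ a b → dist a b ≤ 1) (sym x̂≡y) (sym v̂≡v′) y~v′)) v∈T
         , v̂≡v′

module _ {q m} (T₁ T₂ : VSet q (suc m)) (i : Fin (suc m)) where

  ∈-projPair₊⁻ : ∀ v′ → v′ ∈ₛ projPair₊ i T₁ T₂ → v′ ∈ₛ projection i T₁ × projection i T₂ v′ ≡ false
  ∈-projPair₊⁻ v′ v′∈P with projection i T₁ v′ | projection i T₂ v′
  ... | true | false = refl , refl

  ∈-projPair₊⁺ : ∀ v′ → v′ ∈ₛ projection i T₁ → projection i T₂ v′ ≡ false → v′ ∈ₛ projPair₊ i T₁ T₂
  ∈-projPair₊⁺ v′ v′∈A₁ v′∉A₂ rewrite v′∈A₁ | v′∉A₂ = refl

  projPair-disjoint : Disjoint (projPair₊ i T₁ T₂) (projPair₋ i T₁ T₂)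
  projPair-disjoint v′ (v′∈P₊ , v′∈P₋) = Boolₚ.not-¬ (proj₂ (∈-projPair₊⁻ v′ v′∈P₊))
    (proj₁ (∈-∩⁻ (projection i T₂) (not ∘ projection i T₁) v′ v′∈P₋))

  -- With Aₖ the i-projection of Tₖ: either û ∈ A₂, or û ∈ P₊ ∩ B(x̂) and the bitrade gives a
  -- point of P₋ ∩ B(x̂) ⊆ A₂; either way a point of A₂ ∩ B(x̂) lifts to C_{x,i} ∩ T₂.
  projection-transfer : (∀ y → ballCount y (projPair₊ i T₁ T₂) ≡ ballCount y (projPair₋ i T₁ T₂)) →
    ∀ x → Inhabited (cylinder x i ∩ T₁) → Inhabited (cylinder x i ∩ T₂)
  projection-transfer balanced x (u , u∈CT₁) = transfer (projection i T₂ û) refl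
    where
    x̂ û : Word q m
    x̂ = removeAt x i
    û = removeAt u i
    û∈A₁×B : û ∈ₛ projection i T₁ × dist x̂ û ≤ 1
    û∈A₁×B = cylinder∩⇒projection∩ball i x refl T₁ u u∈CT₁
    lift : ∀ v′ → v′ ∈ₛ projection i T₂ → dist x̂ v′ ≤ 1 → Inhabited (cylinder x i ∩ T₂)
    lift v′ v′∈A₂ x̂~v′ = Product.map₂ proj₁ (projection∩ball⇒cylinder∩ i x refl T₂ v′ v′∈A₂ x̂~v′)
    transfer : ∀ b → projection i T₂ û ≡ b → Inhabited (cylinder x i ∩ T₂)
    transfer true û∈A₂ = lift û û∈A₂ (proj₂ û∈A₁×B)
    transfer false û∉A₂ =
      let (v′ , v′∈P₋∩B) = count≡⇒inhabited (projPair₊ i T₁ T₂ ∩ ball x̂) (projPair₋ i T₁ T₂ ∩ ball x̂) (balanced x̂)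
                             (û , ∈-∩⁺ {A = projPair₊ i T₁ T₂} {ball x̂} (∈-projPair₊⁺ û (proj₁ û∈A₁×B) û∉A₂)
                                    (≤⇒≤ᵇ≡true (proj₂ û∈A₁×B)))
          (v′∈P₋ , v′∈B) = ∈-∩⁻ (projPair₋ i T₁ T₂) (ball x̂) v′ v′∈P₋∩B
      in lift v′ (proj₁ (∈-∩⁻ (projection i T₂) (not ∘ projection i T₁) v′ v′∈P₋)) (≤ᵇ≡true⇒≤ v′∈B)

  module _ (x : Word q (suc m)) {y : Word q m} (x̂≡y : removeAt x i ≡ y)
           (C∩T₁-atMostOne : AtMostOne (cylinder x i ∩ T₁)) where

    lift₁ : ∀ v′ → v′ ∈ₛ projPair₊ i T₁ T₂ ∩ ball y → ∃ λ v → v ∈ₛ cylinder x i ∩ T₁ × removeAt v i ≡ v′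
    lift₁ v′ v′∈P₊∩B =
      let (v′∈P₊ , v′∈B) = ∈-∩⁻ (projPair₊ i T₁ T₂) (ball y) v′ v′∈P₊∩B
      in projection∩ball⇒cylinder∩ i x x̂≡y T₁ v′ (proj₁ (∈-projPair₊⁻ v′ v′∈P₊)) (≤ᵇ≡true⇒≤ v′∈B)

    projPair∩ball-atMostOne : AtMostOne (projPair₊ i T₁ T₂ ∩ ball y)
    projPair∩ball-atMostOne {v₁′} {v₂′} v₁′∈ v₂′∈ =
      let (v₁ , v₁∈ , v̂₁≡v₁′) = lift₁ v₁′ v₁′∈
          (v₂ , v₂∈ , v̂₂≡v₂′) = lift₁ v₂′ v₂′∈
      in trans (sym v̂₁≡v₁′) (trans (cong (λ v → removeAt v i) (C∩T₁-atMostOne v₁∈ v₂∈)) v̂₂≡v₂′)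

    -- The lift u of v′ is the only point of C_{x,i} ∩ T₁, so the point v of C_{x,i} ∩ T₂
    -- projects outside A₁: otherwise v̂ = û = v′ ∉ A₂.
    projPair∩ball-transfer : (Inhabited (cylinder x i ∩ T₁) → Inhabited (cylinder x i ∩ T₂)) →
      Inhabited (projPair₊ i T₁ T₂ ∩ ball y) → Inhabited (projPair₋ i T₁ T₂ ∩ ball y)
    projPair∩ball-transfer transfer (v′ , v′∈P₊∩B) =
      let (u , u∈CT₁ , û≡v′) = lift₁ v′ v′∈P₊∩B
          (v , v∈CT₂) = transfer (u , u∈CT₁)
          (v̂∈A₂ , y~v̂) = cylinder∩⇒projection∩ball i x x̂≡y T₂ v v∈CT₂
      in removeAt v i
       , ∈-∩⁺ {A = projPair₋ i T₁ T₂} {ball y}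
           (∈-∩⁺ {A = projection i T₂} {not ∘ projection i T₁} v̂∈A₂
             (cong not (Boolₚ.¬-not (v̂∉A₁ {v = v} u∈CT₁ û≡v′ v̂∈A₂ y~v̂))))
           (≤⇒≤ᵇ≡true y~v̂)
      where
      v′∉A₂ : projection i T₂ v′ ≡ false
      v′∉A₂ = proj₂ (∈-projPair₊⁻ v′ (proj₁ (∈-∩⁻ (projPair₊ i T₁ T₂) (ball y) v′ v′∈P₊∩B)))
      v̂∉A₁ : ∀ {u v} → u ∈ₛ cylinder x i ∩ T₁ → removeAt u i ≡ v′ → removeAt v i ∈ₛ projection i T₂ →
        dist y (removeAt v i) ≤ 1 → ¬ (removeAt v i ∈ₛ projection i T₁)
      v̂∉A₁ {u} {v} u∈CT₁ û≡v′ v̂∈A₂ y~v̂ v̂∈A₁ =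
        let (u′ , u′∈CT₁ , û′≡v̂) = projection∩ball⇒cylinder∩ i x x̂≡y T₁ (removeAt v i) v̂∈A₁ y~v̂
        in Boolₚ.not-¬ v′∉A₂ (subst (_∈ₛ projection i T₂)
             (trans (sym û′≡v̂) (trans (cong (λ w → removeAt w i) (C∩T₁-atMostOne u′∈CT₁ u∈CT₁)) û≡v′)) v̂∈A₂)

module _ {q m} {T₊ T₋ : VSet q (suc m)} where

  D5-intro : IsCode 4 T₊ → IsCode 4 T₋ →
    (∀ x i → Inhabited (cylinder x i ∩ T₊) → Inhabited (cylinder x i ∩ T₋)) →
    (∀ x i → Inhabited (cylinder x i ∩ T₋) → Inhabited (cylinder x i ∩ T₊)) → D5 T₊ T₋
  D5-intro code₊ code₋ ₊→₋ ₋→₊ x i =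
      count-≡ (cylinder x i ∩ T₊) (cylinder x i ∩ T₋) (code⇒cylCount≤1 code₊ x i) (code⇒cylCount≤1 code₋ x i)
        (₊→₋ x i) (₋→₊ x i)
    , code⇒cylCount≤1 code₊ x i

  D3′⇒D5 : D3′ T₊ T₋ → D5 T₊ T₋
  D3′⇒D5 d3′ = D5-intro code₊ code₋
    (weight-transfer code₊ code₋ (proj₁ ∘ d3′)) (weight-transfer code₋ code₊ (sym ∘ proj₁ ∘ d3′))
    where
    code₊ : IsCode 4 T₊
    code₊ = weight≤n⇒code (proj₂ ∘ d3′)
    code₋ : IsCode 4 T₋
    code₋ = weight≤n⇒code (λ x → subst (_≤ suc m) (proj₁ (d3′ x)) (proj₂ (d3′ x)))

  D5⇒D3′ : D5 T₊ T₋ → D3′ T₊ T₋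
  D5⇒D3′ d5 x =
      trans (sym (∑cylCount≡weight T₊ x)) (trans (sum-cong-≗ (proj₁ ∘ d5 x)) (∑cylCount≡weight T₋ x))
    , subst (_≤ suc m) (∑cylCount≡weight T₊ x) (∑≤n (proj₂ ∘ d5 x))

  D2⇒D5 : D2 T₊ T₋ → D5 T₊ T₋
  D2⇒D5 (code₊ , code₋ , bitrade) = D5-intro code₊ code₋
    (λ x i → projection-transfer T₊ T₋ i (proj₁ ∘ proj₂ (bitrade i)) x)
    (λ x i → projection-transfer T₋ T₊ i (sym ∘ proj₁ ∘ proj₂ (bitrade i)) x)

  D5⇒D2 : Fin q → D5 T₊ T₋ → D2 T₊ T₋
  D5⇒D2 a d5 =
    cylCount≤1⇒code cyl₊≤1 , cylCount≤1⇒code cyl₋≤1 , λ i → projPair-disjoint T₊ T₋ i , bitrade i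
    where
    cyl₊≤1 : ∀ x i → cylCount x i T₊ ≤ 1
    cyl₊≤1 x i = proj₂ (d5 x i)
    cyl₋≤1 : ∀ x i → cylCount x i T₋ ≤ 1
    cyl₋≤1 x i = subst (_≤ 1) (proj₁ (d5 x i)) (proj₂ (d5 x i))
    bitrade : ∀ i y → ballCount y (projPair₊ i T₊ T₋) ≡ ballCount y (projPair₋ i T₊ T₋)
                    × ballCount y (projPair₊ i T₊ T₋) ≤ 1
    bitrade i y = count-≡ (P₊ ∩ ball y) (P₋ ∩ ball y) P₊∩B≤1 P₋∩B≤1
        (projPair∩ball-transfer T₊ T₋ i x x̂≡y (count≤1⇒atMostOne _ (cyl₊≤1 x i))
          (count≡⇒inhabited (cylinder x i ∩ T₊) (cylinder x i ∩ T₋) (proj₁ (d5 x i))))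
        (projPair∩ball-transfer T₋ T₊ i x x̂≡y (count≤1⇒atMostOne _ (cyl₋≤1 x i))
          (count≡⇒inhabited (cylinder x i ∩ T₋) (cylinder x i ∩ T₊) (sym (proj₁ (d5 x i)))))
      , P₊∩B≤1
      where
      P₊ P₋ : VSet q m
      P₊ = projPair₊ i T₊ T₋
      P₋ = projPair₋ i T₊ T₋
      x : Word q (suc m)
      x = insertAt y i a
      x̂≡y : removeAt x i ≡ y
      x̂≡y = Vecₚ.removeAt-insertAt y i a
      P₊∩B≤1 : ballCount y P₊ ≤ 1
      P₊∩B≤1 = atMostOne⇒count≤1 (P₊ ∩ ball y)
        (projPair∩ball-atMostOne T₊ T₋ i x x̂≡y (count≤1⇒atMostOne _ (cyl₊≤1 x i)))
      P₋∩B≤1 : ballCount y P₋ ≤ 1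
      P₋∩B≤1 = atMostOne⇒count≤1 (P₋ ∩ ball y)
        (projPair∩ball-atMostOne T₋ T₊ i x x̂≡y (count≤1⇒atMostOne _ (cyl₋≤1 x i)))

  D3⇔D5 : D3 T₊ T₋ ⇔ D5 T₊ T₋
  D3⇔D5 = mk⇔ (D3′⇒D5 ∘ Equivalence.to (D3⇔D3′ T₊ T₋)) (Equivalence.from (D3⇔D3′ T₊ T₋) ∘ D5⇒D3′)

proposition4 : (q m : ℕ) → 3 ≤ q → (T₊ T₋ : VSet q (suc m)) → Disjoint T₊ T₋ →
    (D2 T₊ T₋ ⇔ D3 T₊ T₋) × (D2 T₊ T₋ ⇔ D5 T₊ T₋)
proposition4 (suc q) m _ T₊ T₋ _ =
    mk⇔ (Equivalence.from D3⇔D5 ∘ D2⇒D5) (D5⇒D2 zero ∘ Equivalence.to D3⇔D5)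
  , mk⇔ D2⇒D5 (D5⇒D2 zero)
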